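{- If $\vdash G\triangleright N$ and $G\parallel\mathcal M\xrightarrow{\beta}G'\parallel\mathcal M'$, then there is a network $N'$ such that $N\parallel\mathcal M\xrightarrow{\beta}N'\parallel\mathcal M'$ and $\vdash G'\triangleright N'$.
   Context: Participants are ranged over by $\mathsf p,\mathsf q,\mathsf r,\mathsf s$ and labels by $\lambda$. Processes are the possibly infinite but regular terms coinductively generated by $P ::= \mathbf 0 \mid \mathsf p!\{\lambda_i;P_i\}_{i\in I}\mid \mathsf p?\{\lambda_i;P_i\}_{i\in I}$, with $I$ finite nonempty and the $\lambda_i$ pairwise distinct. A network is $N=\mathsf p_1[\![P_1]\!]\parallel\cdots\parallel\mathsf p_n[\![P_n]\!]$ with $n>0$ and pairwise distinct $\mathsf p_i$, taken modulo permutation and adding/removing components $\mathsf p[\![\mathbf 0]\!]$; $\mathrm{plays}(N)$ is the set of $\mathsf p$ with $N\equiv\mathsf p[\![P]\!]\parallel N'$, $P\neq\mathbf 0$. A message is a triple $\langle\mathsf p,\lambda,\mathsf q\rangle$; a queue $\mathcal M$ is a finite sequence of messages ($\emptyset$ empty, $\cdot$ concatenation), taken modulo the congruence $\equiv$ generated by swapping adjacent messages $\langle\mathsf p,\lambda,\mathsf q\rangle\cdot\langle\mathsf r,\lambda',\mathsf s\rangle\equiv\langle\mathsf r,\lambda',\mathsf s\rangle\cdot\langle\mathsf p,\lambda,\mathsf q\rangle$ whenever $\mathsf p\neq\mathsf r$ or $\mathsf q\neq\mathsf s$. A session is $N\parallel\mathcal M$. Communications are $\beta::=\mathsf p\mathsf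 q!\lambda\mid\mathsf p\mathsf q?\lambda$ with $\mathrm{play}(\mathsf p\mathsf q!\lambda)=\mathsf p$, $\mathrm{play}(\mathsf p\mathsf q?\lambda)=\mathsf q$. Sessions reduce by: $\mathsf p[\![\mathsf q!\{\lambda_i;P_i\}_{i\in I}]\!]\parallel N\parallel\mathcal M\xrightarrow{\mathsf p\mathsf q!\lambda_h}\mathsf p[\![P_h]\!]\parallel N\parallel\mathcal M\cdot\langle\mathsf p,\lambda_h,\mathsf q\rangle$ and $\mathsf q[\![\mathsf p?\{\lambda_i;Q_i\}_{i\in I}]\!]\parallel N\parallel\langle\mathsf p,\lambda_h,\mathsf q\rangle\cdot\mathcal M\xrightarrow{\mathsf p\mathsf q?\lambda_h}\mathsf q[\![Q_h]\!]\parallel N\parallel\mathcal M$, for $h\in I$. Global types are the possibly infinite regular terms coinductively generated by $G ::= \mathsf{End}\mid \mathsf p\mathsf q!\{\lambda_i;G_i\}_{i\in I}\mid\mathsf p\mathsf q?\{\lambda_i;G_i\}_{i\in I}$ ($I$ finite nonempty, $\mathsf p\neq\mathsf q$, $\lambda_i$ pairwise distinct). $\mathrm{play}(\mathsf p\mathsf q!\{\ldots\})=\mathsf p$, $\mathrm{play}(\mathsf p\mathsf q?\{\ldots\})=\mathsf q$; $\mathrm{plays}(G)$ is the least set with $\mathrm{plays}(\mathsf{End})=\emptyset$ and $\mathrm{plays}(G)=\{\mathrm{play}(G)\}\cup\bigcup_i\mathrm{plays}(G_i)$ for a choice $G$ with continuations $G_i$. Typing $\vdash G\triangleright N$ is defined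 coinductively by: (End) $\vdash\mathsf{End}\triangleright\mathsf p[\![\mathbf 0]\!]$; (Out) if for all $i\in I$, $\vdash G_i\triangleright\mathsf p[\![P_i]\!]\parallel N$ and $\mathrm{plays}(G_i)\setminus\{\mathsf p\}=\mathrm{plays}(N)$, then $\vdash\mathsf p\mathsf q!\{\lambda_i;G_i\}_{i\in I}\triangleright\mathsf p[\![\mathsf q!\{\lambda_i;P_i\}_{i\in I}]\!]\parallel N$; (In) if $I\subseteq J$ and for all $i\in I$, $\vdash G_i\triangleright\mathsf p[\![P_i]\!]\parallel N$ and $\mathrm{plays}(G_i)\setminus\{\mathsf p\}=\mathrm{plays}(N)$, then $\vdash\mathsf q\mathsf p?\{\lambda_i;G_i\}_{i\in I}\triangleright\mathsf p[\![\mathsf q?\{\lambda_j;P_j\}_{j\in J}]\!]\parallel N$. A type configuration is $G\parallel\mathcal M$; its transitions are defined inductively (queues modulo $\equiv$) by: (Top-Out) $\mathsf p\mathsf q!\{\lambda_i;G_i\}_{i\in I}\parallel\mathcal M\xrightarrow{\mathsf p\mathsf q!\lambda_h}G_h\parallel\mathcal M\cdot\langle\mathsf p,\lambda_h,\mathsf q\rangle$ for $h\in I$; (Top-In) $\mathsf p\mathsf q?\{\lambda_i;G_i\}_{i\in I}\parallel\langle\mathsf p,\lambda_h,\mathsf q\rangle\cdot\mathcal M\xrightarrow{\mathsf p\mathsf q?\lambda_h}G_h\parallel\mathcal M$ for $h\in I$; (Inside-Out) if $\mathsf p\neq\mathrm{play}(\beta)$ and $G_i\parallel\mathcal M\cdot\langle\mathsf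 p,\lambda_i,\mathsf q\rangle\xrightarrow{\beta}G'_i\parallel\mathcal M'\cdot\langle\mathsf p,\lambda_i,\mathsf q\rangle$ for all $i\in I$, then $\mathsf p\mathsf q!\{\lambda_i;G_i\}_{i\in I}\parallel\mathcal M\xrightarrow{\beta}\mathsf p\mathsf q!\{\lambda_i;G'_i\}_{i\in I}\parallel\mathcal M'$; (Inside-In) if $\mathsf q\neq\mathrm{play}(\beta)$, $h\in I$ and $G_i\parallel\mathcal M\xrightarrow{\beta}G'_i\parallel\mathcal M'$ for all $i\in I$, then $\mathsf p\mathsf q?\{\lambda_i;G_i\}_{i\in I}\parallel\langle\mathsf p,\lambda_h,\mathsf q\rangle\cdot\mathcal M\xrightarrow{\beta}\mathsf p\mathsf q?\{\lambda_i;G'_i\}_{i\in I}\parallel\langle\mathsf p,\lambda_h,\mathsf q\rangle\cdot\mathcal M'$. -}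

module Defs where

open import Level using (Level; suc; zero)
open import Data.Nat using (ℕ; _≟_)
open import Data.Product using (Σ; _×_; _,_)
open import Data.Sum using (_⊎_)
open import Data.List using (List; []; _∷_; _∷ʳ_; _++_)
open import Data.List.Relation.Unary.Any using (Any)
open import Data.List.Relation.Unary.Unique.Propositional using (Unique)
open import Data.List.Membership.Propositional using (_∈_; _∉_)
open import Relation.Binary.PropositionalEquality using (_≡_; _≢_)
open import Relation.Nullary using (¬_; yes; no)
open import Function.Bundles using (_⇔_)

Part : Set
Part = ℕ

Label : Set
Label = ℕ

Path : Set
Path = List Label

-- A possibly infinite term is represented as the function
-- assigning to every path the node found there (⊘ = no node).
-- A choice  q!{λ_i ; P_i}_{i∈I}  at path π is the node  psend q L  with
-- L the list of labels {λ_i}, and P_i is the subtree at path π ∷ʳ λ_i.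

data PNode : Set where
  p⊘    : PNode
  pend  : PNode
  psend : Part → List Label → PNode
  precv : Part → List Label → PNode

Proc : Set
Proc = Path → PNode

plabels : PNode → List Label
plabels p⊘          = []
plabels pend        = []
plabels (psend _ L) = L
plabels (precv _ L) = L

subP : Proc → Label → Proc
subP P l σ = P (l ∷ σ)

data PNodeOK : PNode → Set where
  ok-pend  : PNodeOK pend
  ok-psend : ∀ {q L} → L ≢ [] → Unique L → PNodeOK (psend q L)
  ok-precv : ∀ {q L} → L ≢ [] → Unique L → PNodeOK (precv q L)

WFProc : Proc → Set
WFProc P =
  (∀ π → P π ≢ p⊘ → PNodeOK (P π)) ×
  (P [] ≢ p⊘) ×
  (∀ π l → (P (π ∷ʳ l) ≢ p⊘) ⇔ (P π ≢ p⊘ × l ∈ plabels (P π)))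

-- regular: finitely many distinct subterms
RegularP : Proc → Set
RegularP P = Σ (List Path) (λ πs → ∀ π → P π ≢ p⊘ →
               Any (λ π' → ∀ σ → P (π ++ σ) ≡ P (π' ++ σ)) πs)

IsProcess : Proc → Set
IsProcess P = WFProc P × RegularP P

data GNode : Set where
  g⊘   : GNode
  gend : GNode
  gout : Part → Part → List Label → GNode
  gin  : Part → Part → List Label → GNode

GT : Set
GT = Path → GNode

glabels : GNode → List Label
glabels g⊘           = []
glabels gend         = []
glabels (gout _ _ L) = L
glabels (gin _ _ L)  = L

subG : GT → Label → GT
subG G l σ = G (l ∷ σ)

data GNodeOK : GNode → Set where
  ok-gend : GNodeOK gend
  ok-gout : ∀ {p q L} → p ≢ q → L ≢ [] → Unique L → GNodeOK (gout p q L)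
  ok-gin  : ∀ {p q L} → p ≢ q → L ≢ [] → Unique L → GNodeOK (gin p q L)

WFG : GT → Set
WFG G =
  (∀ π → G π ≢ g⊘ → GNodeOK (G π)) ×
  (G [] ≢ g⊘) ×
  (∀ π l → (G (π ∷ʳ l) ≢ g⊘) ⇔ (G π ≢ g⊘ × l ∈ glabels (G π)))

RegularG : GT → Set
RegularG G = Σ (List Path) (λ πs → ∀ π → G π ≢ g⊘ →
               Any (λ π' → ∀ σ → G (π ++ σ) ≡ G (π' ++ σ)) πs)

IsGlobalType : GT → Set
IsGlobalType G = WFG G × RegularG G

data Plays (r : Part) (G : GT) : Set where
  pl-out   : ∀ {q L} → G [] ≡ gout r q L → Plays r G
  pl-in    : ∀ {p L} → G [] ≡ gin p r L → Plays r G
  pl-cont  : ∀ {l} → l ∈ glabels (G []) → Plays r (subG G l) → Plays r G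

-- Networks: total maps from participants to processes, absent
-- participants being mapped to 0 (this realises "modulo permutation and
-- adding/removing p[[0]]").

Net : Set
Net = Part → Proc

IsEnd : Proc → Set
IsEnd P = P [] ≡ pend

InPlays : Part → Net → Set
InPlays r N = ¬ IsEnd (N r)

IsNetwork : Net → Set
IsNetwork N =
  Σ (List Part) (λ ps → ∀ r → InPlays r N → r ∈ ps) × (∀ r → IsProcess (N r))

_[_↦_] : Net → Part → Proc → Net
(N [ p ↦ P ]) r with r ≟ p
... | yes _ = P
... | no  _ = N r

-- plays(G) ∖ {p} = plays(N₀) where N = p[[_]] ∥ N₀
PlaysCond : Part → GT → Net → Set
PlaysCond p G N = ∀ r → ((Plays r G × r ≢ p) ⇔ (r ≢ p × InPlays r N))

-- Typing  ⊢ G ▷ N : greatest fixed point of the rules (End), (Out), (In)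

data TypingRule (R : GT → Net → Set) (G : GT) (N : Net) : Set where
  t-end : G [] ≡ gend → (∀ r → IsEnd (N r)) → TypingRule R G N
  t-out : ∀ {p q L L'} → G [] ≡ gout p q L → N p [] ≡ psend q L'
        → (∀ l → (l ∈ L) ⇔ (l ∈ L'))
        → (∀ l → l ∈ L → R (subG G l) (N [ p ↦ subP (N p) l ]) × PlaysCond p (subG G l) N)
        → TypingRule R G N
  t-in  : ∀ {p q L L'} → G [] ≡ gin q p L → N p [] ≡ precv q L'
        → (∀ l → l ∈ L → l ∈ L')
        → (∀ l → l ∈ L → R (subG G l) (N [ p ↦ subP (N p) l ]) × PlaysCond p (subG G l) N)
        → TypingRule R G N

⊢_▷_ : GT → Net → Set₁
⊢ G ▷ N = Σ (GT → Net → Set) (λ R → R G N × (∀ G₀ N₀ → R G₀ N₀ → TypingRule R G₀ N₀))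

record Msg : Set where
  constructor ⟨_,_,_⟩
  field
    sender   : Part
    label    : Label
    receiver : Part

Queue : Set
Queue = List Msg

data _≅_ : Queue → Queue → Set where
  ≅-refl  : ∀ {M} → M ≅ M
  ≅-sym   : ∀ {M M'} → M ≅ M' → M' ≅ M
  ≅-trans : ∀ {M M' M''} → M ≅ M' → M' ≅ M'' → M ≅ M''
  ≅-swap  : ∀ A B {p q r s l l'} → (p ≢ r ⊎ q ≢ s)
          → (A ++ ⟨ p , l , q ⟩ ∷ ⟨ r , l' , s ⟩ ∷ B) ≅ (A ++ ⟨ r , l' , s ⟩ ∷ ⟨ p , l , q ⟩ ∷ B)

data Comm : Set where
  _⇒_!_ : Part → Part → Label → Comm
  _⇒_¿_ : Part → Part → Label → Comm

play : Comm → Part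
play (p ⇒ q ! l) = p
play (p ⇒ q ¿ l) = q

data SessStep : Net → Queue → Comm → Net → Queue → Set where
  s-out : ∀ {N N' M p q L l}
        → N p [] ≡ psend q L → l ∈ L
        → (∀ σ → N' p σ ≡ subP (N p) l σ) → (∀ r → r ≢ p → ∀ σ → N' r σ ≡ N r σ)
        → SessStep N M (p ⇒ q ! l) N' (M ∷ʳ ⟨ p , l , q ⟩)
  s-in  : ∀ {N N' M p q L l}
        → N q [] ≡ precv p L → l ∈ L
        → (∀ σ → N' q σ ≡ subP (N q) l σ) → (∀ r → r ≢ q → ∀ σ → N' r σ ≡ N r σ)
        → SessStep N (⟨ p , l , q ⟩ ∷ M) (p ⇒ q ¿ l) N' M
  s-≅   : ∀ {N N' M₁ M₂ M₁' M₂' β} → M₁ ≅ M₂ → M₁' ≅ M₂'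
        → SessStep N M₁ β N' M₁' → SessStep N M₂ β N' M₂'

data GStep : GT → Queue → Comm → GT → Queue → Set where
  top-out    : ∀ {G G' M p q L l}
             → G [] ≡ gout p q L → l ∈ L → (∀ σ → G' σ ≡ subG G l σ)
             → GStep G M (p ⇒ q ! l) G' (M ∷ʳ ⟨ p , l , q ⟩)
  top-in     : ∀ {G G' M p q L l}
             → G [] ≡ gin p q L → l ∈ L → (∀ σ → G' σ ≡ subG G l σ)
             → GStep G (⟨ p , l , q ⟩ ∷ M) (p ⇒ q ¿ l) G' M
  inside-out : ∀ {G G' M M' p q L β}
             → G [] ≡ gout p q L → p ≢ play β
             → (∀ l → l ∈ L → GStep (subG G l) (M ∷ʳ ⟨ p , l , q ⟩) β (subG G' l) (M' ∷ʳ ⟨ p , l , q ⟩))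
             → G' [] ≡ gout p q L → (∀ l → l ∉ L → ∀ σ → G' (l ∷ σ) ≡ g⊘)
             → GStep G M β G' M'
  inside-in  : ∀ {G G' M M' p q L β h}
             → G [] ≡ gin p q L → q ≢ play β → h ∈ L
             → (∀ l → l ∈ L → GStep (subG G l) M β (subG G' l) M')
             → G' [] ≡ gin p q L → (∀ l → l ∉ L → ∀ σ → G' (l ∷ σ) ≡ g⊘)
             → GStep G (⟨ p , h , q ⟩ ∷ M) β G' (⟨ p , h , q ⟩ ∷ M')
  g-≅        : ∀ {G G' M₁ M₂ M₁' M₂' β} → M₁ ≅ M₂ → M₁' ≅ M₂'
             → GStep G M₁ β G' M₁' → GStep G M₂ β G' M₂'

module Submission where

-- The network is N with the process of play(β) advanced past the label of β. Descending through
-- the Inside rules of the type transition only passes nodes owned by other participants, whose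
-- typing premises leave that process untouched, until a Top rule, where the (Out)/(In) premise
-- shows that the process offers β. Queues are congruent iff they agree on every channel
-- (sender, receiver), so congruence is right-cancellative and the queue moves as in the type.
-- For typing, pairs that are typed, or reached from a typed pair by one transition of the type
-- and the matching advance of the network, form a consistent relation. Finally, subtrees of a
-- regular process are regular (by pigeonhole on prefixes), so the result is again a network.

open import Defs
open import Data.Nat using (ℕ; zero; suc; _+_; _∸_; _⊓_; _≤_; _<_; s≤s; _≟_; _≤?_)
open import Data.Nat.Properties
  using (≰⇒>; m<n⇒m<1+n; m⊓n≤m; +-monoˡ-≤; +-monoˡ-<; m+[n∸m]≡n; module ≤-Reasoning)
open import Data.Nat.Induction using (<-wellFounded)
open import Induction.WellFounded using (Acc; acc)
open import Data.Fin using (Fin; toℕ)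
open import Data.Fin.Properties using (pigeonhole; toℕ≤pred[n])
open import Data.Product using (Σ; _×_; _,_; proj₁; proj₂)
open import Data.Sum using (_⊎_; inj₁; inj₂; [_,_]′)
open import Data.List using (List; []; _∷_; _∷ʳ_; _++_; length; take; drop; map; concatMap; lookup)
open import Data.List.Properties
  using (++-assoc; ++-identityʳ; ++-cancelˡ; ++-cancelʳ; ∷-injectiveˡ;
         length-++; length-take; length-drop; take++drop≡id)
open import Data.List.Relation.Unary.Any as Any using (Any; here; there)
open import Data.List.Relation.Unary.Any.Properties using (lookup-index; map⁺)
open import Data.List.Membership.Propositional using (_∈_; _∉_)
open import Data.List.Membership.DecPropositional _≟_ using (_∈?_)
open import Data.List.Membership.Propositional.Properties using (∈-map⁺; ∈-concatMap⁺)
open import Function.Base using (_∘_; case_of_)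
open import Function.Bundles using (Equivalence; _⇔_; mk⇔)
open import Data.Empty using (⊥-elim)
open import Relation.Binary.PropositionalEquality
open import Relation.Nullary using (¬_; yes; no)

onChannel : Part → Part → Msg → List Label
onChannel a b ⟨ p , l , q ⟩ with a ≟ p | b ≟ q
... | yes _ | yes _ = l ∷ []
... | _     | _     = []

channel : Part → Part → Queue → List Label
channel a b []      = []
channel a b (m ∷ M) = onChannel a b m ++ channel a b M

channel-++ : ∀ a b M K → channel a b (M ++ K) ≡ channel a b M ++ channel a b K
channel-++ a b []      K = refl
channel-++ a b (m ∷ M) K =
  trans (cong (onChannel a b m ++_) (channel-++ a b M K)) (sym (++-assoc (onChannel a b m) _ _))

onChannel-self : ∀ p l q → onChannel p q ⟨ p , l , q ⟩ ≡ l ∷ []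
onChannel-self p l q with p ≟ p | q ≟ q
... | yes _   | yes _   = refl
... | no p≢p  | _       = ⊥-elim (p≢p refl)
... | yes _   | no q≢q  = ⊥-elim (q≢q refl)

onChannel-other : ∀ {p q r s} l → p ≢ r ⊎ q ≢ s → onChannel p q ⟨ r , l , s ⟩ ≡ []
onChannel-other {p} {q} {r} {s} l p≢r⊎q≢s with p ≟ r | q ≟ s
... | yes refl | yes refl = ⊥-elim ([ (λ p≢p → p≢p refl) , (λ q≢q → q≢q refl) ]′ p≢r⊎q≢s)
... | yes _    | no _     = refl
... | no _     | _        = refl

onChannel-comm : ∀ a b {p q r s l l'} → p ≢ r ⊎ q ≢ s →
  onChannel a b ⟨ p , l , q ⟩ ++ onChannel a b ⟨ r , l' , s ⟩ ≡
  onChannel a b ⟨ r , l' , s ⟩ ++ onChannel a b ⟨ p , l , q ⟩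
onChannel-comm a b {p} {q} {l' = l'} p≢r⊎q≢s with a ≟ p | b ≟ q
... | yes refl | yes refl rewrite onChannel-other {a} {b} l' p≢r⊎q≢s = refl
... | yes _    | no _     = sym (++-identityʳ _)
... | no _     | _        = sym (++-identityʳ _)

≅⇒channel : ∀ {M K} → M ≅ K → ∀ a b → channel a b M ≡ channel a b K
≅⇒channel ≅-refl          a b = refl
≅⇒channel (≅-sym K≅M)     a b = sym (≅⇒channel K≅M a b)
≅⇒channel (≅-trans M≅ ≅K) a b = trans (≅⇒channel M≅ a b) (≅⇒channel ≅K a b)
≅⇒channel (≅-swap A B {p} {q} {r} {s} {l} {l'} p≢r⊎q≢s) a b = begin
  channel a b (A ++ m ∷ m' ∷ B)             ≡⟨ channel-++ a b A _ ⟩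
  channel a b A ++ (x ++ (y ++ channel a b B)) ≡⟨ cong (channel a b A ++_) exchange ⟩
  channel a b A ++ (y ++ (x ++ channel a b B)) ≡⟨ channel-++ a b A _ ⟨
  channel a b (A ++ m' ∷ m ∷ B)             ∎
  where
  open ≡-Reasoning
  m  = ⟨ p , l , q ⟩
  m' = ⟨ r , l' , s ⟩
  x  = onChannel a b m
  y  = onChannel a b m'
  exchange : x ++ (y ++ channel a b B) ≡ y ++ (x ++ channel a b B)
  exchange = begin
    x ++ (y ++ channel a b B) ≡⟨ ++-assoc x y _ ⟨
    (x ++ y) ++ channel a b B ≡⟨ cong (_++ channel a b B) (onChannel-comm a b p≢r⊎q≢s) ⟩
    (y ++ x) ++ channel a b B ≡⟨ ++-assoc y x _ ⟩
    y ++ (x ++ channel a b B) ∎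

≅-cons : ∀ m {M K} → M ≅ K → (m ∷ M) ≅ (m ∷ K)
≅-cons m ≅-refl          = ≅-refl
≅-cons m (≅-sym K≅M)     = ≅-sym (≅-cons m K≅M)
≅-cons m (≅-trans M≅ ≅K) = ≅-trans (≅-cons m M≅) (≅-cons m ≅K)
≅-cons m (≅-swap A B d)  = ≅-swap (m ∷ A) B d

≅-snoc : ∀ m {M K} → M ≅ K → (M ∷ʳ m) ≅ (K ∷ʳ m)
≅-snoc m ≅-refl          = ≅-refl
≅-snoc m (≅-sym K≅M)     = ≅-sym (≅-snoc m K≅M)
≅-snoc m (≅-trans M≅ ≅K) = ≅-trans (≅-snoc m M≅) (≅-snoc m ≅K)
≅-snoc m (≅-swap A B {p} {q} {r} {s} {l} {l'} d)
  rewrite ++-assoc A (⟨ p , l , q ⟩ ∷ ⟨ r , l' , s ⟩ ∷ B) (m ∷ [])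
        | ++-assoc A (⟨ r , l' , s ⟩ ∷ ⟨ p , l , q ⟩ ∷ B) (m ∷ [])
  = ≅-swap A (B ∷ʳ m) d

≅-pull : ∀ {p q r s l l' K K'} → p ≢ r ⊎ q ≢ s → K ≅ (⟨ r , l' , s ⟩ ∷ K') →
  (⟨ p , l , q ⟩ ∷ K) ≅ (⟨ r , l' , s ⟩ ∷ ⟨ p , l , q ⟩ ∷ K')
≅-pull {K' = K'} p≢r⊎q≢s K≅ = ≅-trans (≅-cons _ K≅) (≅-swap [] K' p≢r⊎q≢s)

channel-front : ∀ a b K {l ls} → channel a b K ≡ l ∷ ls → Σ Queue λ K' → K ≅ (⟨ a , l , b ⟩ ∷ K')
channel-front a b (⟨ p , l' , q ⟩ ∷ K) e with a ≟ p | b ≟ q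
... | yes refl | yes refl with refl ← ∷-injectiveˡ e = K , ≅-refl
... | yes _    | no b≢q   = let K' , K≅ = channel-front a b K e in _ , ≅-pull (inj₂ (≢-sym b≢q)) K≅
... | no a≢p   | _        = let K' , K≅ = channel-front a b K e in _ , ≅-pull (inj₁ (≢-sym a≢p)) K≅

channels⇒≅ : ∀ M K → (∀ a b → channel a b M ≡ channel a b K) → M ≅ K
channels⇒≅ [] [] _ = ≅-refl
channels⇒≅ [] (⟨ p , l , q ⟩ ∷ K) same with () ← trans (same p q) (cong (_++ _) (onChannel-self p l q))
channels⇒≅ (⟨ p , l , q ⟩ ∷ M) K same = ≅-trans (≅-cons _ (channels⇒≅ M K' same')) (≅-sym K≅)
  where
  front = channel-front p q K (trans (sym (same p q)) (cong (_++ _) (onChannel-self p l q)))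
  K' = proj₁ front
  K≅ = proj₂ front
  same' : ∀ a b → channel a b M ≡ channel a b K'
  same' a b = ++-cancelˡ (onChannel a b ⟨ p , l , q ⟩) _ _ (trans (same a b) (≅⇒channel K≅ a b))

≅-∷ʳ-cancel : ∀ {M K} m → (M ∷ʳ m) ≅ (K ∷ʳ m) → M ≅ K
≅-∷ʳ-cancel {M} {K} m M∷m≅K∷m = channels⇒≅ M K λ a b →
  ++-cancelʳ (channel a b (m ∷ [])) _ _ (begin
    channel a b M ++ channel a b (m ∷ []) ≡⟨ channel-++ a b M _ ⟨
    channel a b (M ∷ʳ m)                 ≡⟨ ≅⇒channel M∷m≅K∷m a b ⟩
    channel a b (K ∷ʳ m)                 ≡⟨ channel-++ a b K _ ⟩
    channel a b K ++ channel a b (m ∷ []) ∎)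
  where open ≡-Reasoning

length-take++drop< : ∀ {A : Set} {i j} (xs : List A) → i < j → j ≤ length xs →
  length (take i xs ++ drop j xs) < length xs
length-take++drop< {i = i} {j} xs i<j j≤n = begin-strict
  length (take i xs ++ drop j xs)         ≡⟨ length-++ (take i xs) ⟩
  length (take i xs) + length (drop j xs) ≡⟨ cong₂ _+_ (length-take i xs) (length-drop j xs) ⟩
  i ⊓ n + (n ∸ j)                         ≤⟨ +-monoˡ-≤ (n ∸ j) (m⊓n≤m i n) ⟩
  i + (n ∸ j)                             <⟨ +-monoˡ-< (n ∸ j) i<j ⟩
  j + (n ∸ j)                             ≡⟨ m+[n∸m]≡n j≤n ⟩
  n                                       ∎
  where
  open ≤-Reasoning
  n = length xs

Subtree : Proc → Path → Proc
Subtree P π σ = P (π ++ σ)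

SubtreesAmong : Proc → List Proc → Set
SubtreesAmong P Ts = ∀ π → P π ≢ p⊘ → Any (Subtree P π ≗_) Ts

ChildClosed : Proc → Set
ChildClosed P = ∀ π l → P (π ∷ʳ l) ≢ p⊘ → P π ≢ p⊘ × l ∈ plabels (P π)

Subtree-root : ∀ {P π π'} → Subtree P π ≗ Subtree P π' → P π ≡ P π'
Subtree-root {P} {π} {π'} same =
  trans (cong P (sym (++-identityʳ π))) (trans (same []) (cong P (++-identityʳ π')))

Subtree-++ : ∀ {P α α'} → Subtree P α ≗ Subtree P α' → ∀ β → Subtree P (α ++ β) ≗ Subtree P (α' ++ β)
Subtree-++ {P} {α} {α'} same β σ = begin
  P ((α ++ β) ++ σ)  ≡⟨ cong P (++-assoc α β σ) ⟩
  P (α ++ β ++ σ)    ≡⟨ same (β ++ σ) ⟩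
  P (α' ++ β ++ σ)   ≡⟨ cong P (++-assoc α' β σ) ⟨
  P ((α' ++ β) ++ σ) ∎
  where open ≡-Reasoning

Subtree-cut : ∀ {P} π {i j} → Subtree P (take j π) ≗ Subtree P (take i π) →
  Subtree P π ≗ Subtree P (take i π ++ drop j π)
Subtree-cut {P} π {i} {j} same σ =
  trans (cong (λ ρ → P (ρ ++ σ)) (sym (take++drop≡id j π))) (Subtree-++ {P} same (drop j π) σ)

prefix-≢⊘ : ∀ {P} → ChildClosed P → ∀ π ρ → P (π ++ ρ) ≢ p⊘ → P π ≢ p⊘
prefix-≢⊘         closed []      []      h = h
prefix-≢⊘ {P}     closed []      (l ∷ ρ) h =
  proj₁ (closed [] l (prefix-≢⊘ {subP P l} (λ π → closed (l ∷ π)) [] ρ h))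
prefix-≢⊘ {P}     closed (l ∷ π) ρ       h = prefix-≢⊘ {subP P l} (λ π' → closed (l ∷ π')) π ρ h

pathsUpTo : Proc → ℕ → List Path
pathsUpTo P zero    = [] ∷ []
pathsUpTo P (suc d) = [] ∷ concatMap (λ l → map (l ∷_) (pathsUpTo (subP P l) d)) (plabels (P []))

∈-pathsUpTo : ∀ {P} → ChildClosed P → ∀ d π → P π ≢ p⊘ → length π ≤ d → π ∈ pathsUpTo P d
∈-pathsUpTo closed zero    []      _ _ = here refl
∈-pathsUpTo closed (suc d) []      _ _ = here refl
∈-pathsUpTo {P} closed (suc d) (l ∷ π) h (s≤s |π|≤d) =
  there (∈-concatMap⁺ (λ l' → map (l' ∷_) (pathsUpTo (subP P l') d))
           (Any.map (λ { refl → ∈-map⁺ (l ∷_) π∈ }) l∈))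
  where
  l∈ = proj₂ (closed [] l (prefix-≢⊘ closed (l ∷ []) π h))
  π∈ = ∈-pathsUpTo {subP P l} (λ π' → closed (l ∷ π')) d π h |π|≤d

module _ {P : Proc} {Ts : List Proc} (closed : ChildClosed P) (among : SubtreesAmong P Ts) where

  -- Pigeonhole: among the length π + 1 prefixes of a path longer than Ts two root the same
  -- subtree, and cutting out the segment between them does not change the subtree at π.
  shorten : ∀ π → Acc _<_ (length π) → P π ≢ p⊘ →
    Σ Path λ π' → length π' ≤ length Ts × Subtree P π ≗ Subtree P π'
  shorten π _ h with length π ≤? length Ts
  ... | yes short = π , short , λ _ → refl
  shorten π (acc smaller) h | no long =
    let i , j , i<j , same-class = pigeonhole (m<n⇒m<1+n (≰⇒> long)) prefix-class
        same = Subtree-cut {P} π (λ σ → trans (prefix-same j σ)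
                 (trans (cong (λ c → lookup Ts c σ) (sym same-class)) (sym (prefix-same i σ))))
        π' , short , same' = shorten (take (toℕ i) π ++ drop (toℕ j) π)
                               (smaller (length-take++drop< π i<j (toℕ≤pred[n] j)))
                               (subst (_≢ p⊘) (Subtree-root {P} same) h)
    in π' , short , λ σ → trans (same σ) (same' σ)
    where
    prefix-found : (k : Fin (suc (length π))) → Any (Subtree P (take (toℕ k) π) ≗_) Ts
    prefix-found k = among (take (toℕ k) π) (prefix-≢⊘ closed (take (toℕ k) π) (drop (toℕ k) π)
      (subst (λ ρ → P ρ ≢ p⊘) (sym (take++drop≡id (toℕ k) π)) h))
    prefix-class : Fin (suc (length π)) → Fin (length Ts)
    prefix-class k = Any.index (prefix-found k)
    prefix-same : ∀ k → Subtree P (take (toℕ k) π) ≗ lookup Ts (prefix-class k)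
    prefix-same k = lookup-index (prefix-found k)

  SubtreesAmong⇒RegularP : RegularP P
  SubtreesAmong⇒RegularP = pathsUpTo P (length Ts) , λ π h →
    let π' , short , same = shorten π (<-wellFounded (length π)) h
    in Any.map (λ { refl → same })
         (∈-pathsUpTo closed (length Ts) π' (subst (_≢ p⊘) (Subtree-root {P} same) h) short)

RegularP⇒SubtreesAmong : ∀ {P} (reg : RegularP P) → SubtreesAmong P (map (Subtree P) (proj₁ reg))
RegularP⇒SubtreesAmong reg π h = map⁺ (proj₂ reg π h)

IsProcess-subP : ∀ {P l} → IsProcess P → l ∈ plabels (P []) → IsProcess (subP P l)
IsProcess-subP {P} {l} ((nodesOK , root , children) , reg) l∈ =
  ((λ π → nodesOK (l ∷ π)) , from (children [] l) (root , l∈) , (λ π → children (l ∷ π))) ,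
  SubtreesAmong⇒RegularP (λ π l' → to (children (l ∷ π) l')) (λ π → RegularP⇒SubtreesAmong reg (l ∷ π))
  where open Equivalence

_≗ₙ_ : Net → Net → Set
N ≗ₙ N' = ∀ r → N r ≗ N' r

≗ₙ-sym : ∀ {N N'} → N ≗ₙ N' → N' ≗ₙ N
≗ₙ-sym N≗ r σ = sym (N≗ r σ)

update-here : ∀ N p P → (N [ p ↦ P ]) p ≡ P
update-here N p P with p ≟ p
... | yes _   = refl
... | no p≢p  = ⊥-elim (p≢p refl)

update-there : ∀ N {p r} P → r ≢ p → (N [ p ↦ P ]) r ≡ N r
update-there N {p} {r} P r≢p with r ≟ p
... | yes r≡p = ⊥-elim (r≢p r≡p)
... | no _    = refl

update-cong : ∀ {N N' P P'} p → N ≗ₙ N' → P ≗ P' → (N [ p ↦ P ]) ≗ₙ (N' [ p ↦ P' ])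
update-cong p N≗ P≗ r with r ≟ p
... | yes _ = P≗
... | no _  = N≗ r

InPlays-≗ₙ : ∀ {r N N'} → N ≗ₙ N' → InPlays r N → InPlays r N'
InPlays-≗ₙ {r} N≗ active end = active (trans (N≗ r []) end)

commLabel : Comm → Label
commLabel (p ⇒ q ! l) = l
commLabel (p ⇒ q ¿ l) = l

advance : Net → Comm → Net
advance N β = N [ play β ↦ subP (N (play β)) (commLabel β) ]

advance-there : ∀ N β {r} → r ≢ play β → advance N β r ≡ N r
advance-there N β = update-there N _

advance-update : ∀ {N N₀ p l} β → p ≢ play β → N ≗ₙ advance N₀ β →
  (N [ p ↦ subP (N p) l ]) ≗ₙ advance (N₀ [ p ↦ subP (N₀ p) l ]) β
advance-update {N} {N₀} {p} {l} β p≢β N≗ r σ with r ≟ play β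
... | yes refl = begin
  (N [ p ↦ _ ]) r σ                  ≡⟨ cong-app (update-there N _ (≢-sym p≢β)) σ ⟩
  N r σ                              ≡⟨ N≗ r σ ⟩
  advance N₀ β r σ                   ≡⟨ cong-app (update-here N₀ r _) σ ⟩
  N₀ r (commLabel β ∷ σ)             ≡⟨ cong-app (update-there N₀ _ (≢-sym p≢β)) (commLabel β ∷ σ) ⟨
  (N₀ [ p ↦ _ ]) r (commLabel β ∷ σ) ∎
  where open ≡-Reasoning
... | no r≢β with r ≟ p
...   | yes refl = trans (N≗ r (l ∷ σ)) (cong-app (advance-there N₀ β r≢β) (l ∷ σ))
...   | no _     = trans (N≗ r σ) (cong-app (advance-there N₀ β r≢β) σ)

Enabled : Net → Comm → Set
Enabled N (p ⇒ q ! l) = Σ (List Label) λ L → N p [] ≡ psend q L × l ∈ L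
Enabled N (p ⇒ q ¿ l) = Σ (List Label) λ L → N q [] ≡ precv p L × l ∈ L

Enabled-update : ∀ {N p P} β → play β ≢ p → Enabled (N [ p ↦ P ]) β → Enabled N β
Enabled-update {N} (_ ⇒ _ ! _) β≢p (L , offers , l∈) = L , trans (sym (cong-app (update-there N _ β≢p) [])) offers , l∈
Enabled-update {N} (_ ⇒ _ ¿ _) β≢p (L , offers , l∈) = L , trans (sym (cong-app (update-there N _ β≢p) [])) offers , l∈

Enabled⇒label∈ : ∀ {N} β → Enabled N β → commLabel β ∈ plabels (N (play β) [])
Enabled⇒label∈ (_ ⇒ _ ! _) (_ , offers , l∈) rewrite offers = l∈
Enabled⇒label∈ (_ ⇒ _ ¿ _) (_ , offers , l∈) rewrite offers = l∈

Enabled⇒InPlays : ∀ {N} β → Enabled N β → InPlays (play β) N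
Enabled⇒InPlays (_ ⇒ _ ! _) (_ , offers , _) end with () ← trans (sym offers) end
Enabled⇒InPlays (_ ⇒ _ ¿ _) (_ , offers , _) end with () ← trans (sym offers) end

IsNetwork-advance : ∀ {N} β → IsNetwork N → Enabled N β → IsNetwork (advance N β)
IsNetwork-advance {N} β ((ps , finite) , processes) enabled = (ps , finite') , processes'
  where
  finite' : ∀ r → InPlays r (advance N β) → r ∈ ps
  finite' r active with r ≟ play β
  ... | yes refl = finite r (Enabled⇒InPlays β enabled)
  ... | no _     = finite r active
  processes' : ∀ r → IsProcess (advance N β r)
  processes' r with r ≟ play β
  ... | yes refl = IsProcess-subP (processes r) (Enabled⇒label∈ β enabled)
  ... | no _     = processes r

QueueEffect : Queue → Comm → Queue → Set
QueueEffect M (p ⇒ q ! l) M' = M' ≅ (M ∷ʳ ⟨ p , l , q ⟩)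
QueueEffect M (p ⇒ q ¿ l) M' = M ≅ (⟨ p , l , q ⟩ ∷ M')

SessStep-advance : ∀ {N M M'} β → Enabled N β → QueueEffect M β M' → SessStep N M β (advance N β) M'
SessStep-advance {N} (p ⇒ q ! l) (_ , offers , l∈) M'≅ =
  s-≅ ≅-refl (≅-sym M'≅) (s-out offers l∈ (cong-app (update-here N p _)) (λ r r≢p → cong-app (update-there N _ r≢p)))
SessStep-advance {N} (p ⇒ q ¿ l) (_ , offers , l∈) M≅ =
  s-≅ (≅-sym M≅) ≅-refl (s-in offers l∈ (cong-app (update-here N q _)) (λ r r≢q → cong-app (update-there N _ r≢q)))

NodesOK : GT → Set
NodesOK G = ∀ π → G π ≢ g⊘ → GNodeOK (G π)

NodesOK-subG : ∀ {G} → NodesOK G → ∀ l → NodesOK (subG G l)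
NodesOK-subG ok l π = ok (l ∷ π)

GNodeOK-branch : ∀ {x} → GNodeOK x → x ≢ gend → Σ Label (_∈ glabels x)
GNodeOK-branch ok-gend                     x≢end = ⊥-elim (x≢end refl)
GNodeOK-branch (ok-gout {L = []}    _ L≢[] _) _ = ⊥-elim (L≢[] refl)
GNodeOK-branch (ok-gout {L = l ∷ _} _ _    _) _ = l , here refl
GNodeOK-branch (ok-gin  {L = []}    _ L≢[] _) _ = ⊥-elim (L≢[] refl)
GNodeOK-branch (ok-gin  {L = l ∷ _} _ _    _) _ = l , here refl

root-branch : ∀ {G x} → NodesOK G → G [] ≡ x → x ≢ g⊘ → x ≢ gend → Σ Label (_∈ glabels x)
root-branch ok refl x≢⊘ = GNodeOK-branch (ok [] x≢⊘)

data Player (p : Part) : GNode → Set where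
  player-out : ∀ {q L} → Player p (gout p q L)
  player-in  : ∀ {q L} → Player p (gin q p L)

Player-unique : ∀ {p r x} → Player p x → Player r x → p ≡ r
Player-unique player-out player-out = refl
Player-unique player-in  player-in  = refl

Plays-player : ∀ {p G x} → G [] ≡ x → Player p x → Plays p G
Plays-player root player-out = pl-out root
Plays-player root player-in  = pl-in root

Plays-branch : ∀ {p r G x} → G [] ≡ x → Player p x → Plays r G → r ≢ p →
  Σ Label λ l → l ∈ glabels x × Plays r (subG G l)
Plays-branch root player (pl-out root') r≢p =
  ⊥-elim (r≢p (Player-unique (subst (Player _) (trans (sym root') root) player-out) player))
Plays-branch root player (pl-in root') r≢p =
  ⊥-elim (r≢p (Player-unique (subst (Player _) (trans (sym root') root) player-in) player))
Plays-branch root player (pl-cont {l} l∈ plays) _ = l , subst (λ x → l ∈ glabels x) root l∈ , plays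

¬Plays-end : ∀ {r G} → G [] ≡ gend → ¬ Plays r G
¬Plays-end end (pl-out root) with () ← trans (sym end) root
¬Plays-end end (pl-in root)  with () ← trans (sym end) root
¬Plays-end end (pl-cont l∈ _) rewrite end with () ← l∈

Plays-≗ : ∀ {r G G'} → G ≗ G' → Plays r G → Plays r G'
Plays-≗ G≗ (pl-out root)         = pl-out (trans (sym (G≗ [])) root)
Plays-≗ G≗ (pl-in root)          = pl-in (trans (sym (G≗ [])) root)
Plays-≗ G≗ (pl-cont {l} l∈ plays) =
  pl-cont (subst (λ x → l ∈ glabels x) (G≗ []) l∈) (Plays-≗ (λ σ → G≗ (l ∷ σ)) plays)

PlaysCond-≗ : ∀ {p G G' N N'} → G ≗ G' → N ≗ₙ N' → PlaysCond p G N → PlaysCond p G' N'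
PlaysCond-≗ G≗ N≗ cond r = mk⇔
  (λ (plays , r≢p) → let _ , active = to (cond r) (Plays-≗ (sym ∘ G≗) plays , r≢p) in r≢p , InPlays-≗ₙ N≗ active)
  (λ (r≢p , active) → let plays , _ = from (cond r) (r≢p , InPlays-≗ₙ (≗ₙ-sym N≗) active) in Plays-≗ G≗ plays , r≢p)
  where open Equivalence

Plays⇔⇒PlaysCond : ∀ {p P G N} → (∀ r → Plays r G ⇔ InPlays r (N [ p ↦ P ])) → PlaysCond p G N
Plays⇔⇒PlaysCond {N = N} plays⇔ r = mk⇔
  (λ (plays , r≢p) → r≢p , subst (λ P → ¬ IsEnd P) (update-there N _ r≢p) (to (plays⇔ r) plays))
  (λ (r≢p , active) → from (plays⇔ r) (subst (λ P → ¬ IsEnd P) (sym (update-there N _ r≢p)) active) , r≢p)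
  where open Equivalence

-- Any other participant than p plays in G iff it plays in some branch, iff (by the premise of
-- that branch) it plays in N.
Plays⇔InPlays-player : ∀ {p G N x} → G [] ≡ x → Player p x → InPlays p N → Σ Label (_∈ glabels x) →
  (∀ l → l ∈ glabels x → PlaysCond p (subG G l) N) → ∀ r → Plays r G ⇔ InPlays r N
Plays⇔InPlays-player {p} root player active (l , l∈) conds r with r ≟ p
... | yes refl = mk⇔ (λ _ → active) (λ _ → Plays-player root player)
... | no r≢p   = mk⇔
  (λ plays → let l' , l'∈ , plays' = Plays-branch root player plays r≢p in proj₂ (to (conds l' l'∈ r) (plays' , r≢p)))
  (λ active' → pl-cont (subst (λ x → l ∈ glabels x) (sym root) l∈) (proj₁ (from (conds l l∈ r) (r≢p , active'))))
  where open Equivalence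

TypingRule⇒Plays⇔InPlays : ∀ {R G N} → NodesOK G → TypingRule R G N → ∀ r → Plays r G ⇔ InPlays r N
TypingRule⇒Plays⇔InPlays ok (t-end end ends) r = mk⇔ (⊥-elim ∘ ¬Plays-end end) (λ active → ⊥-elim (active (ends r)))
TypingRule⇒Plays⇔InPlays {N = N} ok (t-out root sends _ next) =
  Plays⇔InPlays-player {N = N} root player-out (λ end → case trans (sym sends) end of λ ())
    (root-branch ok root (λ ()) (λ ())) (λ l l∈ → proj₂ (next l l∈))
TypingRule⇒Plays⇔InPlays {N = N} ok (t-in root receives _ next) =
  Plays⇔InPlays-player {N = N} root player-in (λ end → case trans (sym receives) end of λ ())
    (root-branch ok root (λ ()) (λ ())) (λ l l∈ → proj₂ (next l l∈))

NodesOK-node : ∀ {G L} → (G [] ≢ g⊘ → GNodeOK (G [])) → (∀ l → l ∉ L → ∀ σ → G (l ∷ σ) ≡ g⊘) →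
  (∀ l → l ∈ L → NodesOK (subG G l)) → NodesOK G
NodesOK-node root-ok outside branches-ok []      = root-ok
NodesOK-node {L = L} root-ok outside branches-ok (l ∷ π) with l ∈? L
... | yes l∈ = branches-ok l l∈ π
... | no l∉  = λ l∷π≢⊘ → ⊥-elim (l∷π≢⊘ (outside l l∉ π))

NodesOK-step : ∀ {G M β G' M'} → NodesOK G → GStep G M β G' M' → NodesOK G'
NodesOK-step ok (top-out {l = l} _ _ G'≗) π = subst (λ x → x ≢ g⊘ → GNodeOK x) (sym (G'≗ π)) (ok (l ∷ π))
NodesOK-step ok (top-in  {l = l} _ _ G'≗) π = subst (λ x → x ≢ g⊘ → GNodeOK x) (sym (G'≗ π)) (ok (l ∷ π))
NodesOK-step ok (inside-out root _ steps root' outside) =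
  NodesOK-node (subst (λ x → x ≢ g⊘ → GNodeOK x) (trans root (sym root')) (ok []))
    outside (λ l l∈ → NodesOK-step (NodesOK-subG ok l) (steps l l∈))
NodesOK-step ok (inside-in root _ _ steps root' outside) =
  NodesOK-node (subst (λ x → x ≢ g⊘ → GNodeOK x) (trans root (sym root')) (ok []))
    outside (λ l l∈ → NodesOK-step (NodesOK-subG ok l) (steps l l∈))
NodesOK-step ok (g-≅ _ _ step) = NodesOK-step ok step

≅-swap-last : ∀ M {p q r s l l'} → p ≢ r ⊎ q ≢ s →
  ((M ∷ʳ ⟨ p , l , q ⟩) ∷ʳ ⟨ r , l' , s ⟩) ≅ ((M ∷ʳ ⟨ r , l' , s ⟩) ∷ʳ ⟨ p , l , q ⟩)
≅-swap-last M {p} {q} {r} {s} {l} {l'} p≢r⊎q≢s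
  rewrite ++-assoc M (⟨ p , l , q ⟩ ∷ []) (⟨ r , l' , s ⟩ ∷ [])
        | ++-assoc M (⟨ r , l' , s ⟩ ∷ []) (⟨ p , l , q ⟩ ∷ [])
  = ≅-swap M [] p≢r⊎q≢s

QueueEffect-≅ : ∀ β {M₁ M₂ M₁' M₂'} → M₁ ≅ M₂ → M₁' ≅ M₂' → QueueEffect M₁ β M₁' → QueueEffect M₂ β M₂'
QueueEffect-≅ (_ ⇒ _ ! _) M₁≅ M₁'≅ eff = ≅-trans (≅-sym M₁'≅) (≅-trans eff (≅-snoc _ M₁≅))
QueueEffect-≅ (_ ⇒ _ ¿ _) M₁≅ M₁'≅ eff = ≅-trans (≅-sym M₁≅) (≅-trans eff (≅-cons _ M₁'≅))

QueueEffect-unsnoc : ∀ β {M M' p l q} → p ≢ play β →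
  QueueEffect (M ∷ʳ ⟨ p , l , q ⟩) β (M' ∷ʳ ⟨ p , l , q ⟩) → QueueEffect M β M'
QueueEffect-unsnoc (_ ⇒ _ ! _) {M} p≢β eff = ≅-∷ʳ-cancel _ (≅-trans eff (≅-swap-last M (inj₁ p≢β)))
QueueEffect-unsnoc (_ ⇒ _ ¿ _)     p≢β eff = ≅-∷ʳ-cancel _ eff

QueueEffect-cons : ∀ β {M M' p l q} → q ≢ play β →
  QueueEffect M β M' → QueueEffect (⟨ p , l , q ⟩ ∷ M) β (⟨ p , l , q ⟩ ∷ M')
QueueEffect-cons (_ ⇒ _ ! _) q≢β eff = ≅-cons _ eff
QueueEffect-cons (_ ⇒ _ ¿ _) q≢β eff = ≅-pull (inj₂ q≢β) eff

QueueEffect-step : ∀ {G M β G' M'} → NodesOK G → GStep G M β G' M' → QueueEffect M β M'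
QueueEffect-step ok (top-out _ _ _) = ≅-refl
QueueEffect-step ok (top-in _ _ _)  = ≅-refl
QueueEffect-step {β = β} ok (inside-out root p≢β steps _ _) =
  let l , l∈ = root-branch ok root (λ ()) (λ ())
  in QueueEffect-unsnoc β p≢β (QueueEffect-step (NodesOK-subG ok l) (steps l l∈))
QueueEffect-step {β = β} ok (inside-in {h = h} _ q≢β h∈ steps _ _) =
  QueueEffect-cons β q≢β (QueueEffect-step (NodesOK-subG ok h) (steps h h∈))
QueueEffect-step {β = β} ok (g-≅ M≅ M'≅ step) = QueueEffect-≅ β M≅ M'≅ (QueueEffect-step ok step)

Branches : (GT → Net → Set) → GT → Net → Part → List Label → Set
Branches R G N p L = ∀ l → l ∈ L → R (subG G l) (N [ p ↦ subP (N p) l ]) × PlaysCond p (subG G l) N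

module _ (R : GT → Net → Set) (consistent : ∀ G N → R G N → TypingRule R G N) where

  invert-out : ∀ {G N p q L} → R G N → G [] ≡ gout p q L →
    Σ (List Label) λ L' → N p [] ≡ psend q L' × (∀ l → (l ∈ L) ⇔ (l ∈ L')) × Branches R G N p L
  invert-out {G} {N} typing root with consistent G N typing
  ... | t-end end _                 with () ← trans (sym root) end
  ... | t-in root' _ _ _            with () ← trans (sym root) root'
  ... | t-out root' sends same next with refl ← trans (sym root) root' = _ , sends , same , next

  invert-in : ∀ {G N p q L} → R G N → G [] ≡ gin q p L →
    Σ (List Label) λ L' → N p [] ≡ precv q L' × (∀ l → l ∈ L → l ∈ L') × Branches R G N p L
  invert-in {G} {N} typing root with consistent G N typing
  ... | t-end end _                   with () ← trans (sym root) end
  ... | t-out root' _ _ _             with () ← trans (sym root) root'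
  ... | t-in root' receives sub next with refl ← trans (sym root) root' = _ , receives , sub , next

  Enabled-step : ∀ {G N M β G' M'} → NodesOK G → R G N → GStep G M β G' M' → Enabled N β
  Enabled-step ok typing (top-out {l = l} root l∈ _) =
    let L' , sends , same , _ = invert-out typing root in L' , sends , Equivalence.to (same l) l∈
  Enabled-step ok typing (top-in root l∈ _) =
    let L' , receives , sub , _ = invert-in typing root in L' , receives , sub _ l∈
  Enabled-step ok typing (inside-out {β = β} root p≢β steps _ _) =
    let l , l∈ = root-branch ok root (λ ()) (λ ())
        _ , _ , _ , next = invert-out typing root
    in Enabled-update β (≢-sym p≢β) (Enabled-step (NodesOK-subG ok l) (proj₁ (next l l∈)) (steps l l∈))
  Enabled-step ok typing (inside-in {β = β} {h = h} root q≢β h∈ steps _ _) =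
    let _ , _ , _ , next = invert-in typing root
    in Enabled-update β (≢-sym q≢β) (Enabled-step (NodesOK-subG ok h) (proj₁ (next h h∈)) (steps h h∈))
  Enabled-step ok typing (g-≅ _ _ step) = Enabled-step ok typing step

  data Reached (G : GT) (N : Net) : Set where
    typed   : ∀ {G₀ N₀} → R G₀ N₀ → G ≗ G₀ → N ≗ₙ N₀ → Reached G N
    stepped : ∀ {G₀ N₀ M β M'} → NodesOK G₀ → R G₀ N₀ → GStep G₀ M β G M' → N ≗ₙ advance N₀ β → Reached G N

  typed-branches : ∀ {G₀ N₀ G N p L} → Branches R G₀ N₀ p L → G ≗ G₀ → N ≗ₙ N₀ → Branches Reached G N p L
  typed-branches {p = p} next G≗ N≗ l l∈ =
    typed (proj₁ (next l l∈)) (λ σ → G≗ (l ∷ σ)) (update-cong p N≗ (λ σ → N≗ p (l ∷ σ))) ,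
    PlaysCond-≗ (λ σ → sym (G≗ (l ∷ σ))) (≗ₙ-sym N≗) (proj₂ (next l l∈))

  typed-consistent : ∀ {G₀ N₀ G N} → R G₀ N₀ → G ≗ G₀ → N ≗ₙ N₀ → TypingRule Reached G N
  typed-consistent {G₀} {N₀} typing G≗ N≗ with consistent G₀ N₀ typing
  ... | t-end end ends                  = t-end (trans (G≗ []) end) (λ r → trans (N≗ r []) (ends r))
  ... | t-out {p} root sends same next  =
    t-out (trans (G≗ []) root) (trans (N≗ p []) sends) same (typed-branches next G≗ N≗)
  ... | t-in {p} root receives sub next =
    t-in (trans (G≗ []) root) (trans (N≗ p []) receives) sub (typed-branches next G≗ N≗)

  stepped-consistent : ∀ {G₀ N₀ M β G M' N} → NodesOK G₀ → R G₀ N₀ → GStep G₀ M β G M' →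
    N ≗ₙ advance N₀ β → TypingRule Reached G N

  -- The side condition plays(G_l) ∖ {p} = plays(N) of a stepped branch comes from the
  -- consistency of that branch itself, through TypingRule⇒Plays⇔InPlays.
  stepped-branch : ∀ {G₀ N₀ M β G M' N p} l → p ≢ play β → NodesOK (subG G₀ l) →
    R (subG G₀ l) (N₀ [ p ↦ subP (N₀ p) l ]) → GStep (subG G₀ l) M β (subG G l) M' → N ≗ₙ advance N₀ β →
    Reached (subG G l) (N [ p ↦ subP (N p) l ]) × PlaysCond p (subG G l) N
  stepped-branch {β = β} l p≢β ok typing step N≗ =
    stepped ok typing step N≗' ,
    Plays⇔⇒PlaysCond (TypingRule⇒Plays⇔InPlays (NodesOK-step ok step) (stepped-consistent ok typing step N≗'))
    where N≗' = advance-update β p≢β N≗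

  stepped-consistent ok typing (top-out {l = l} root l∈ G≗) N≗ =
    let _ , _ , _ , next = invert-out typing root in typed-consistent (proj₁ (next l l∈)) G≗ N≗
  stepped-consistent ok typing (top-in {l = l} root l∈ G≗) N≗ =
    let _ , _ , _ , next = invert-in typing root in typed-consistent (proj₁ (next l l∈)) G≗ N≗
  stepped-consistent {G₀} {N₀} {β = β} {G} ok typing (inside-out {p = p} root p≢β steps root' _) N≗ =
    let _ , sends , same , next = invert-out typing root in
    t-out root' (trans (N≗ p []) (trans (cong-app (advance-there N₀ β p≢β) []) sends)) same
      λ l l∈ → stepped-branch {G₀} {G = G} l p≢β (NodesOK-subG ok l) (proj₁ (next l l∈)) (steps l l∈) N≗
  stepped-consistent {G₀} {N₀} {β = β} {G} ok typing (inside-in {q = q} root q≢β _ steps root' _) N≗ =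
    let _ , receives , sub , next = invert-in typing root in
    t-in root' (trans (N≗ q []) (trans (cong-app (advance-there N₀ β q≢β) []) receives)) sub
      λ l l∈ → stepped-branch {G₀} {G = G} l q≢β (NodesOK-subG ok l) (proj₁ (next l l∈)) (steps l l∈) N≗
  stepped-consistent ok typing (g-≅ _ _ step) N≗ = stepped-consistent ok typing step N≗

  Reached-consistent : ∀ G N → Reached G N → TypingRule Reached G N
  Reached-consistent G N (typed typing G≗ N≗)        = typed-consistent typing G≗ N≗
  Reached-consistent G N (stepped ok typing step N≗) = stepped-consistent ok typing step N≗

theorem3p9 : (G G' : GT) (N : Net) (M M' : Queue) (β : Comm)
    → IsGlobalType G → IsNetwork N
    → ⊢ G ▷ N → GStep G M β G' M'
    → Σ Net (λ N' → IsNetwork N' × SessStep N M β N' M' × ⊢ G' ▷ N')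
theorem3p9 G G' N M M' β ((ok , _) , _) network (R , typing , consistent) step =
  advance N β ,
  IsNetwork-advance β network enabled ,
  SessStep-advance β enabled (QueueEffect-step ok step) ,
  (Reached R consistent , stepped ok typing step (λ _ _ → refl) , Reached-consistent R consistent)
  where
  enabled : Enabled N β
  enabled = Enabled-step R consistent ok typing step
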